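{- $\displaystyle\sum_{i=0}^\infty t_i=\prod_{i=1}^\infty(1+\ell^{ -i})^{ -1}.$
   Context: $\ell$ is an odd prime. For $k\ge0$, $(\ell^{ -1})_k=\prod_{j=1}^{k}(1-\ell^{ -j})$. For $k\ge1$ let $r_k=-1/\big(\ell^{k(k+1)/2}(\ell^{ -1})_k\big)$. For a finite set $S$ of nonnegative integers and an integer $i>\max S$ (with $i\ge1$), write $S\cup\{0\}=\{s_0,\dots,s_j\}$ with $0=s_0<s_1<\cdots<s_j$, put $s_{j+1}=i$, and set $r^i_S=\prod_{k=0}^{j}r_{s_{k+1}-s_k}$. Let $t_0=1$, $t_1=r^1_\varnothing$, and for $i>1$, $t_i=\sum_{S\subseteq\{1,\dots,i-1\}}r^i_S$. -}

module Defs where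

open import Data.Nat as ℕ using (ℕ; zero; suc)
open import Data.Integer using (+_)
open import Data.Rational using (ℚ; 0ℚ; 1ℚ; _+_; _*_; _-_; -_; 1/_; ≢-nonZero; _/_)
open import Data.Rational.Properties using (_≟_)
open import Data.List using (List; []; _∷_; map; _++_; foldr; upTo)
open import Relation.Nullary using (yes; no)

ℕ→ℚ : ℕ → ℚ
ℕ→ℚ n = + n / 1

-- total multiplicative inverse on ℚ (junk value 0 at 0; only ever applied
-- to nonzero arguments below when ℓ ≥ 2)
inv : ℚ → ℚ
inv p with p ≟ 0ℚ
... | yes _  = 0ℚ
... | no p≢0 = 1/_ p {{≢-nonZero p≢0}}

_^ℚ_ : ℚ → ℕ → ℚ
x ^ℚ zero  = 1ℚ
x ^ℚ suc n = x * (x ^ℚ n)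

sumℚ : List ℚ → ℚ
sumℚ = foldr _+_ 0ℚ

prodℚ : List ℚ → ℚ
prodℚ = foldr _*_ 1ℚ

oneTo : ℕ → List ℕ
oneTo m = map suc (upTo m)

-- all sublists (order-preserving), i.e. all subsets of a list of distinct
-- elements; each subset of an increasing list comes out increasing
powerset : List ℕ → List (List ℕ)
powerset []       = [] ∷ []
powerset (x ∷ xs) = map (x ∷_) (powerset xs) ++ powerset xs

ℓinv : ℕ → ℚ
ℓinv ℓ = inv (ℕ→ℚ ℓ)

poch : ℕ → ℕ → ℚ
poch ℓ k = prodℚ (map (λ j → 1ℚ - (ℓinv ℓ ^ℚ j)) (oneTo k))

r : ℕ → ℕ → ℚ
r ℓ k = - inv (ℕ→ℚ (ℓ ℕ.^ ((k ℕ.* suc k) ℕ./ 2)) * poch ℓ k)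

-- product of r over consecutive gaps of  prev < s₁ < ... < s_j < i
rChain : ℕ → ℕ → List ℕ → ℕ → ℚ
rChain ℓ prev []       i = r ℓ (i ℕ.∸ prev)
rChain ℓ prev (s ∷ ss) i = r ℓ (s ℕ.∸ prev) * rChain ℓ s ss i

-- r^i_S  with S ∪ {0} = {0 = s₀ < s₁ < ... < s_j}, s_{j+1} = i
rS : ℕ → ℕ → List ℕ → ℚ
rS ℓ i S = rChain ℓ 0 S i

t : ℕ → ℕ → ℚ
t ℓ zero    = 1ℚ
t ℓ (suc m) = sumℚ (map (rS ℓ (suc m)) (powerset (oneTo m)))

partialSum : ℕ → ℕ → ℚ
partialSum ℓ n = sumℚ (map (t ℓ) (upTo n))

partialProd : ℕ → ℕ → ℚ
partialProd ℓ n = prodℚ (map (λ i → inv (1ℚ + (ℓinv ℓ ^ℚ i))) (oneTo n))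

-- Put q = ℓ⁻¹ ≤ 1/3. Then -r_k = q^(k(k+1)/2) / (q; q)ₖ are the coefficients of (-qx; q)_∞
-- (Euler), and splitting each chain at its first point shows that the tᵢ are the coefficients
-- of the reciprocal series 1 / (-qx; q)_∞, namely tₘ = (-q)ᵐ / (q; q)ₘ, so |tₘ| ≤ 2⁻ᵐ.
-- The truncations E_M(z) = Σ_{m<M} tₘ zᵐ satisfy E_{M+1}(qz) = (1 + qz) E_M(z) + t_M z^M.
-- Dividing by 1 + qᵏ for k = 1, …, n therefore carries E_n(1) to within 2·2⁻ⁿ of
-- ∏_{k ≤ n} (1 + qᵏ)⁻¹ · E_{2n}(qⁿ), and E_{2n}(qⁿ) is within qⁿ ≤ 2⁻ⁿ of 1.
{-# OPTIONS --safe #-}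
module Submission where

open import Data.Integer as ℤ using (+≤+)
import Data.Integer.Properties as ℤ
open import Data.List using (List; []; _∷_; map; _++_; upTo; applyUpTo; iterate)
open import Data.List.Properties using (map-++; map-∘; map-applyUpTo; upTo-∷ʳ)
open import Data.Nat as ℕ using (ℕ; zero; suc; z≤n; s≤s)
import Data.Nat.Properties as ℕ
import Data.Nat.Coprimality as Coprimality
open import Data.Nat.DivMod using (+-distrib-/-∣ˡ; m*n/n≡m)
open import Data.Nat.Divisibility using (_∣_; ∣-refl; divides)
open import Data.Nat.Primality using (Prime; ¬prime[0]; ¬prime[1])
import Data.Nat.Tactic.RingSolver as ℕ-Ring
open import Data.Product using (∃; _,_; map₂)
open import Data.Rational
  using ( ℚ; mkℚ; 0ℚ; 1ℚ; ½; _+_; _*_; _-_; -_; _/_; _≤_; _<_; ∣_∣; ↧ₙ_; *≤*; *<*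
        ; ≢-nonZero; nonNegative; positive)
open import Data.Rational.Properties
open import Data.Unit using (tt)
open import Function using (_∘_)
open import Level using (0ℓ)
open import Relation.Binary.PropositionalEquality
open import Relation.Nullary using (¬_; Dec; yes; no; contradiction)
open import Relation.Nullary.Decidable using (dec⇒maybe)
open import Tactic.RingSolver using (solve-∀)
import Tactic.RingSolver.Core.AlmostCommutativeRing as ACR

open import Defs

ℚ-ring : ACR.AlmostCommutativeRing 0ℓ 0ℓ
ℚ-ring = ACR.fromCommutativeRing +-*-commutativeRing (λ p → dec⇒maybe (0ℚ ≟ p))

inv-inverseˡ : ∀ {p} → p ≢ 0ℚ → inv p * p ≡ 1ℚ
inv-inverseˡ {p} p≢0 with p ≟ 0ℚ
... | yes p≡0 = contradiction p≡0 p≢0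
... | no  p≢0 = *-inverseˡ p {{≢-nonZero p≢0}}

inv-inverseʳ : ∀ {p} → p ≢ 0ℚ → p * inv p ≡ 1ℚ
inv-inverseʳ {p} p≢0 = trans (*-comm p (inv p)) (inv-inverseˡ p≢0)

p*q*inv[q]≡p : ∀ p {q} → q ≢ 0ℚ → p * q * inv q ≡ p
p*q*inv[q]≡p p {q} q≢0 = begin
  p * q * inv q    ≡⟨ *-assoc p q (inv q) ⟩
  p * (q * inv q)  ≡⟨ cong (p *_) (inv-inverseʳ q≢0) ⟩
  p * 1ℚ           ≡⟨ *-identityʳ p ⟩
  p                ∎
  where open ≡-Reasoning

p*inv[q]*q≡p : ∀ p {q} → q ≢ 0ℚ → p * inv q * q ≡ p
p*inv[q]*q≡p p {q} q≢0 = begin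
  p * inv q * q    ≡⟨ *-assoc p (inv q) q ⟩
  p * (inv q * q)  ≡⟨ cong (p *_) (inv-inverseˡ q≢0) ⟩
  p * 1ℚ           ≡⟨ *-identityʳ p ⟩
  p                ∎
  where open ≡-Reasoning

inv-unique : ∀ {p q} → p * q ≡ 1ℚ → p ≡ inv q
inv-unique {p} {q} pq≡1 = begin
  p              ≡⟨ sym (p*q*inv[q]≡p p q≢0) ⟩
  p * q * inv q  ≡⟨ cong (_* inv q) pq≡1 ⟩
  1ℚ * inv q     ≡⟨ *-identityˡ (inv q) ⟩
  inv q          ∎
  where
  open ≡-Reasoning
  q≢0 : q ≢ 0ℚ
  q≢0 refl with trans (sym (*-zeroʳ p)) pq≡1
  ... | ()

p*q≡0⇒p≡0 : ∀ {p q} → q ≢ 0ℚ → p * q ≡ 0ℚ → p ≡ 0ℚ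
p*q≡0⇒p≡0 {p} {q} q≢0 pq≡0 = begin
  p              ≡⟨ sym (p*q*inv[q]≡p p q≢0) ⟩
  p * q * inv q  ≡⟨ cong (_* inv q) pq≡0 ⟩
  0ℚ * inv q     ≡⟨ *-zeroˡ (inv q) ⟩
  0ℚ             ∎
  where open ≡-Reasoning

inv-distrib-* : ∀ p q → inv (p * q) ≡ inv p * inv q
inv-distrib-* p q = by-cases (p ≟ 0ℚ) (q ≟ 0ℚ)
  where
  interchange : ∀ a b c d → a * b * (c * d) ≡ a * c * (b * d)
  interchange = solve-∀ ℚ-ring
  by-cases : Dec (p ≡ 0ℚ) → Dec (q ≡ 0ℚ) → inv (p * q) ≡ inv p * inv q
  by-cases (yes refl) _          = trans (cong inv (*-zeroˡ q)) (sym (*-zeroˡ (inv q)))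
  by-cases (no _)     (yes refl) = trans (cong inv (*-zeroʳ p)) (sym (*-zeroʳ (inv p)))
  by-cases (no p≢0)   (no q≢0)   = sym (inv-unique (trans (interchange (inv p) (inv q) p q)
    (cong₂ _*_ (inv-inverseˡ p≢0) (inv-inverseˡ q≢0))))

inv-pos : ∀ {p} → 0ℚ < p → 0ℚ < inv p
inv-pos {p} 0<p with p ≟ 0ℚ
... | yes p≡0 = contradiction (sym p≡0) (<⇒≢ 0<p)
... | no  _   = positive⁻¹ _ {{1/pos⇒pos p {{positive 0<p}}}}

∣inv∣≤1 : ∀ {p} → 1ℚ ≤ p → ∣ inv p ∣ ≤ 1ℚ
∣inv∣≤1 {p} 1≤p = begin
  ∣ inv p ∣     ≡⟨ 0≤p⇒∣p∣≡p 0≤inv ⟩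
  inv p         ≡⟨ sym (*-identityʳ (inv p)) ⟩
  inv p * 1ℚ    ≤⟨ *-monoˡ-≤-nonNeg (inv p) {{nonNegative 0≤inv}} 1≤p ⟩
  inv p * p     ≡⟨ inv-inverseˡ p≢0 ⟩
  1ℚ            ∎
  where
  open ≤-Reasoning
  0<p : 0ℚ < p
  0<p = <-≤-trans (positive⁻¹ 1ℚ) 1≤p
  p≢0 : p ≢ 0ℚ
  p≢0 = ≢-sym (<⇒≢ 0<p)
  0≤inv : 0ℚ ≤ inv p
  0≤inv = <⇒≤ (inv-pos 0<p)

*<1⇒<inv : ∀ {p q} → 0ℚ < q → p * q < 1ℚ → p < inv q
*<1⇒<inv {p} {q} 0<q pq<1 = begin-strict
  p              ≡⟨ sym (p*q*inv[q]≡p p (≢-sym (<⇒≢ 0<q))) ⟩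
  p * q * inv q  <⟨ *-monoˡ-<-pos (inv q) {{positive (inv-pos 0<q)}} pq<1 ⟩
  1ℚ * inv q     ≡⟨ *-identityˡ (inv q) ⟩
  inv q          ∎
  where open ≤-Reasoning

p≤p+q : ∀ {p q} → 0ℚ ≤ q → p ≤ p + q
p≤p+q {p} {q} 0≤q = subst (_≤ p + q) (+-identityʳ p) (+-monoʳ-≤ p 0≤q)

0<1-p : ∀ {p} → p < 1ℚ → 0ℚ < 1ℚ - p
0<1-p {p} p<1 = subst (_< 1ℚ - p) (+-inverseʳ p) (+-monoˡ-< (- p) p<1)

*-nonNeg : ∀ {p q} → 0ℚ ≤ p → 0ℚ ≤ q → 0ℚ ≤ p * q
*-nonNeg {p} {q} 0≤p 0≤q =
  nonNegative⁻¹ (p * q) {{nonNeg*nonNeg⇒nonNeg p {{nonNegative 0≤p}} q {{nonNegative 0≤q}}}}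

*-mono-≤-nonNeg : ∀ {p q r s} → 0ℚ ≤ p → 0ℚ ≤ r → p ≤ q → r ≤ s → p * r ≤ q * s
*-mono-≤-nonNeg {p} {q} {r} {s} 0≤p 0≤r p≤q r≤s =
  ≤-trans (*-monoʳ-≤-nonNeg r {{nonNegative 0≤r}} p≤q)
          (*-monoˡ-≤-nonNeg q {{nonNegative (≤-trans 0≤p p≤q)}} r≤s)

∣*∣-mono-≤ : ∀ {p q r s} → ∣ p ∣ ≤ q → ∣ r ∣ ≤ s → ∣ p * r ∣ ≤ q * s
∣*∣-mono-≤ {p} {q} {r} {s} ∣p∣≤q ∣r∣≤s = subst (_≤ q * s) (sym (∣p*q∣≡∣p∣*∣q∣ p r))
  (*-mono-≤-nonNeg (0≤∣p∣ p) (0≤∣p∣ r) ∣p∣≤q ∣r∣≤s)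

∣p-r∣≤∣p-q∣+∣q-r∣ : ∀ p q r → ∣ p - r ∣ ≤ ∣ p - q ∣ + ∣ q - r ∣
∣p-r∣≤∣p-q∣+∣q-r∣ p q r = subst (λ x → ∣ x ∣ ≤ ∣ p - q ∣ + ∣ q - r ∣) (split p q r)
  (∣p+q∣≤∣p∣+∣q∣ (p - q) (q - r))
  where
  split : ∀ p q r → (p - q) + (q - r) ≡ p - r
  split = solve-∀ ℚ-ring

^ℚ-distribˡ-+-* : ∀ x m n → x ^ℚ (m ℕ.+ n) ≡ x ^ℚ m * x ^ℚ n
^ℚ-distribˡ-+-* x zero    n = sym (*-identityˡ (x ^ℚ n))
^ℚ-distribˡ-+-* x (suc m) n =
  trans (cong (x *_) (^ℚ-distribˡ-+-* x m n)) (sym (*-assoc x (x ^ℚ m) (x ^ℚ n)))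

^ℚ-distribʳ-* : ∀ x y n → (x * y) ^ℚ n ≡ x ^ℚ n * y ^ℚ n
^ℚ-distribʳ-* x y zero    = refl
^ℚ-distribʳ-* x y (suc n) =
  trans (cong (x * y *_) (^ℚ-distribʳ-* x y n)) (interchange x y (x ^ℚ n) (y ^ℚ n))
  where
  interchange : ∀ a b c d → a * b * (c * d) ≡ a * c * (b * d)
  interchange = solve-∀ ℚ-ring

1^ℚn≡1 : ∀ n → 1ℚ ^ℚ n ≡ 1ℚ
1^ℚn≡1 zero    = refl
1^ℚn≡1 (suc n) = trans (*-identityˡ (1ℚ ^ℚ n)) (1^ℚn≡1 n)

^ℚ-nonNeg : ∀ {x} n → 0ℚ ≤ x → 0ℚ ≤ x ^ℚ n
^ℚ-nonNeg zero    _   = ≤ᵇ⇒≤ tt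
^ℚ-nonNeg (suc n) 0≤x = *-nonNeg 0≤x (^ℚ-nonNeg n 0≤x)

∣^ℚ∣≤^ℚ : ∀ {x y} n → ∣ x ∣ ≤ y → ∣ x ^ℚ n ∣ ≤ y ^ℚ n
∣^ℚ∣≤^ℚ zero    _      = ≤-refl
∣^ℚ∣≤^ℚ (suc n) ∣x∣≤y = ∣*∣-mono-≤ ∣x∣≤y (∣^ℚ∣≤^ℚ n ∣x∣≤y)

∣^ℚ∣≤1 : ∀ {x} n → ∣ x ∣ ≤ 1ℚ → ∣ x ^ℚ n ∣ ≤ 1ℚ
∣^ℚ∣≤1 {x} n ∣x∣≤1 = subst (∣ x ^ℚ n ∣ ≤_) (1^ℚn≡1 n) (∣^ℚ∣≤^ℚ n ∣x∣≤1)

ℕ→ℚ≡mkℚ : ∀ n → ℕ→ℚ n ≡ mkℚ (ℤ.+ n) 0 (Coprimality.sym (Coprimality.1-coprimeTo n))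
ℕ→ℚ≡mkℚ n = normalize-coprime (Coprimality.sym (Coprimality.1-coprimeTo n))

ℕ→ℚ-+ : ∀ m n → ℕ→ℚ (m ℕ.+ n) ≡ ℕ→ℚ m + ℕ→ℚ n
ℕ→ℚ-+ m n = trans (cong (_/ 1) numerators) (sym (cong₂ _+_ (ℕ→ℚ≡mkℚ m) (ℕ→ℚ≡mkℚ n)))
  where
  numerators : ℤ.+ (m ℕ.+ n) ≡ ℤ.+ m ℤ.* ℤ.+ 1 ℤ.+ ℤ.+ n ℤ.* ℤ.+ 1
  numerators = trans (ℤ.pos-+ m n)
    (sym (cong₂ ℤ._+_ (ℤ.*-identityʳ (ℤ.+ m)) (ℤ.*-identityʳ (ℤ.+ n))))

ℕ→ℚ-* : ∀ m n → ℕ→ℚ (m ℕ.* n) ≡ ℕ→ℚ m * ℕ→ℚ n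
ℕ→ℚ-* m n = trans (cong (_/ 1) (ℤ.pos-* m n)) (sym (cong₂ _*_ (ℕ→ℚ≡mkℚ m) (ℕ→ℚ≡mkℚ n)))

ℕ→ℚ-mono-≤ : ∀ {m n} → m ℕ.≤ n → ℕ→ℚ m ≤ ℕ→ℚ n
ℕ→ℚ-mono-≤ {m} {n} m≤n rewrite ℕ→ℚ≡mkℚ m | ℕ→ℚ≡mkℚ n =
  *≤* (ℤ.*-monoʳ-≤-nonNeg (ℤ.+ 1) (+≤+ m≤n))

ℕ→ℚ-mono-< : ∀ {m n} → m ℕ.< n → ℕ→ℚ m < ℕ→ℚ n
ℕ→ℚ-mono-< {m} {n} m<n rewrite ℕ→ℚ≡mkℚ m | ℕ→ℚ≡mkℚ n =
  *<* (ℤ.*-monoʳ-<-pos (ℤ.+ 1) (ℤ.+<+ m<n))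

inv-ℕ→ℚ-^ : ∀ n m → inv (ℕ→ℚ (n ℕ.^ m)) ≡ inv (ℕ→ℚ n) ^ℚ m
inv-ℕ→ℚ-^ n zero    = refl
inv-ℕ→ℚ-^ n (suc m) = begin
  inv (ℕ→ℚ (n ℕ.* n ℕ.^ m))            ≡⟨ cong inv (ℕ→ℚ-* n (n ℕ.^ m)) ⟩
  inv (ℕ→ℚ n * ℕ→ℚ (n ℕ.^ m))          ≡⟨ inv-distrib-* (ℕ→ℚ n) (ℕ→ℚ (n ℕ.^ m)) ⟩
  inv (ℕ→ℚ n) * inv (ℕ→ℚ (n ℕ.^ m))    ≡⟨ cong (inv (ℕ→ℚ n) *_) (inv-ℕ→ℚ-^ n m) ⟩
  inv (ℕ→ℚ n) * inv (ℕ→ℚ n) ^ℚ m       ∎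
  where open ≡-Reasoning

0<½^ : ∀ n → 0ℚ < ½ ^ℚ n
0<½^ zero    = positive⁻¹ 1ℚ
0<½^ (suc n) = positive⁻¹ (½ * ½ ^ℚ n) {{pos*pos⇒pos ½ (½ ^ℚ n) {{positive (0<½^ n)}}}}

0≤½^ : ∀ n → 0ℚ ≤ ½ ^ℚ n
0≤½^ n = <⇒≤ (0<½^ n)

½<1 : ½ < 1ℚ
½<1 = *<* (ℤ.+<+ (s≤s (s≤s z≤n)))

½^n*[1+n]≤1 : ∀ n → ½ ^ℚ n * ℕ→ℚ (suc n) ≤ 1ℚ
½^n*[1+n]≤1 zero    = ≤-refl
½^n*[1+n]≤1 (suc n) = begin
  ½ * ½ ^ℚ n * ℕ→ℚ (2 ℕ.+ n)                   ≤⟨ *-monoˡ-≤-nonNeg (½ * ½ ^ℚ n) {{nonNegative (0≤½^ (suc n))}}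
                                                    (ℕ→ℚ-mono-≤ (s≤s (ℕ.m≤n+m (suc n) n))) ⟩
  ½ * ½ ^ℚ n * ℕ→ℚ (suc n ℕ.+ suc n)           ≡⟨ cong (½ * ½ ^ℚ n *_) (ℕ→ℚ-+ (suc n) (suc n)) ⟩
  ½ * ½ ^ℚ n * (ℕ→ℚ (suc n) + ℕ→ℚ (suc n))     ≡⟨ halve (½ ^ℚ n) (ℕ→ℚ (suc n)) ⟩
  ½ ^ℚ n * ℕ→ℚ (suc n)                         ≤⟨ ½^n*[1+n]≤1 n ⟩
  1ℚ                                           ∎
  where
  open ≤-Reasoning
  halve : ∀ h x → ½ * h * (x + x) ≡ h * x
  halve = solve-∀ ℚ-ring

inv[↧ₙp]≤p : ∀ p → 0ℚ < p → inv (ℕ→ℚ (↧ₙ p)) ≤ p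
inv[↧ₙp]≤p (mkℚ (ℤ.+ zero)    _ _) (*<* (ℤ.+<+ ()))
inv[↧ₙp]≤p (mkℚ ℤ.-[1+ _ ]    _ _) (*<* ())
inv[↧ₙp]≤p (mkℚ (ℤ.+ suc n) d-1 _) _ rewrite ℕ→ℚ≡mkℚ (suc d-1) =
  *≤* (+≤+ (ℕ.*-monoˡ-≤ (suc d-1) (s≤s (z≤n {n}))))

c*½^n-eventually< : ∀ c ε → 0ℚ < ε → ∃ λ N → ∀ n → N ℕ.≤ n → ℕ→ℚ c * ½ ^ℚ n < ε
c*½^n-eventually< c ε 0<ε = c ℕ.* ↧ₙ ε , λ n N≤n →
  <-≤-trans (*<1⇒<inv (ℕ→ℚ-mono-< {0} {↧ₙ ε} (s≤s z≤n)) (bound n N≤n)) (inv[↧ₙp]≤p ε 0<ε)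
  where
  reorder : ∀ c h d → c * h * d ≡ h * (c * d)
  reorder = solve-∀ ℚ-ring
  bound : ∀ n → c ℕ.* ↧ₙ ε ℕ.≤ n → ℕ→ℚ c * ½ ^ℚ n * ℕ→ℚ (↧ₙ ε) < 1ℚ
  bound n N≤n = begin-strict
    ℕ→ℚ c * ½ ^ℚ n * ℕ→ℚ (↧ₙ ε)     ≡⟨ reorder (ℕ→ℚ c) (½ ^ℚ n) (ℕ→ℚ (↧ₙ ε)) ⟩
    ½ ^ℚ n * (ℕ→ℚ c * ℕ→ℚ (↧ₙ ε))   ≡⟨ cong (½ ^ℚ n *_) (ℕ→ℚ-* c (↧ₙ ε)) ⟨
    ½ ^ℚ n * ℕ→ℚ (c ℕ.* ↧ₙ ε)       ≤⟨ *-monoˡ-≤-nonNeg (½ ^ℚ n) {{nonNegative (0≤½^ n)}}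
                                         (ℕ→ℚ-mono-≤ N≤n) ⟩
    ½ ^ℚ n * ℕ→ℚ n                  <⟨ *-monoʳ-<-pos (½ ^ℚ n) {{positive (0<½^ n)}}
                                         (ℕ→ℚ-mono-< (ℕ.n<1+n n)) ⟩
    ½ ^ℚ n * ℕ→ℚ (suc n)            ≤⟨ ½^n*[1+n]≤1 n ⟩
    1ℚ                              ∎
    where open ≤-Reasoning

sumℚ-++ : ∀ xs ys → sumℚ (xs ++ ys) ≡ sumℚ xs + sumℚ ys
sumℚ-++ []       ys = sym (+-identityˡ (sumℚ ys))
sumℚ-++ (x ∷ xs) ys = trans (cong (x +_) (sumℚ-++ xs ys)) (sym (+-assoc x (sumℚ xs) (sumℚ ys)))

prodℚ-++ : ∀ xs ys → prodℚ (xs ++ ys) ≡ prodℚ xs * prodℚ ys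
prodℚ-++ []       ys = sym (*-identityˡ (prodℚ ys))
prodℚ-++ (x ∷ xs) ys = trans (cong (x *_) (prodℚ-++ xs ys)) (sym (*-assoc x (prodℚ xs) (prodℚ ys)))

sumℚ-map-*ˡ : ∀ {A : Set} c (f : A → ℚ) xs → sumℚ (map (λ x → c * f x) xs) ≡ c * sumℚ (map f xs)
sumℚ-map-*ˡ c f []       = sym (*-zeroʳ c)
sumℚ-map-*ˡ c f (x ∷ xs) =
  trans (cong (c * f x +_) (sumℚ-map-*ˡ c f xs)) (sym (*-distribˡ-+ c (f x) (sumℚ (map f xs))))

map-upTo-suc : ∀ {A : Set} (f : ℕ → A) n → map f (upTo (suc n)) ≡ map f (upTo n) ++ f n ∷ []
map-upTo-suc f n = trans (cong (map f) (sym (upTo-∷ʳ n))) (map-++ f (upTo n) (n ∷ []))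

map-oneTo-suc : ∀ {A : Set} (f : ℕ → A) n → map f (oneTo (suc n)) ≡ map f (oneTo n) ++ f (suc n) ∷ []
map-oneTo-suc f n = begin
  map f (map suc (upTo (suc n)))            ≡⟨ map-∘ (upTo (suc n)) ⟨
  map (f ∘ suc) (upTo (suc n))              ≡⟨ map-upTo-suc (f ∘ suc) n ⟩
  map (f ∘ suc) (upTo n) ++ f (suc n) ∷ []  ≡⟨ cong (_++ f (suc n) ∷ []) (map-∘ (upTo n)) ⟩
  map f (oneTo n) ++ f (suc n) ∷ []         ∎
  where open ≡-Reasoning

sumℚ-upTo-suc : ∀ (f : ℕ → ℚ) n → sumℚ (map f (upTo (suc n))) ≡ sumℚ (map f (upTo n)) + f n
sumℚ-upTo-suc f n = begin
  sumℚ (map f (upTo (suc n)))                ≡⟨ cong sumℚ (map-upTo-suc f n) ⟩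
  sumℚ (map f (upTo n) ++ f n ∷ [])          ≡⟨ sumℚ-++ (map f (upTo n)) (f n ∷ []) ⟩
  sumℚ (map f (upTo n)) + (f n + 0ℚ)         ≡⟨ cong (sumℚ (map f (upTo n)) +_) (+-identityʳ (f n)) ⟩
  sumℚ (map f (upTo n)) + f n                ∎
  where open ≡-Reasoning

prodℚ-oneTo-suc : ∀ (f : ℕ → ℚ) n →
                  prodℚ (map f (oneTo (suc n))) ≡ prodℚ (map f (oneTo n)) * f (suc n)
prodℚ-oneTo-suc f n = begin
  prodℚ (map f (oneTo (suc n)))               ≡⟨ cong prodℚ (map-oneTo-suc f n) ⟩
  prodℚ (map f (oneTo n) ++ f (suc n) ∷ [])   ≡⟨ prodℚ-++ (map f (oneTo n)) (f (suc n) ∷ []) ⟩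
  prodℚ (map f (oneTo n)) * (f (suc n) * 1ℚ)  ≡⟨ cong (prodℚ (map f (oneTo n)) *_) (*-identityʳ (f (suc n))) ⟩
  prodℚ (map f (oneTo n)) * f (suc n)         ∎
  where open ≡-Reasoning

sumℚ-powerset-∷ : ∀ (f : List ℕ → ℚ) x xs → sumℚ (map f (powerset (x ∷ xs))) ≡
                  sumℚ (map (f ∘ (x ∷_)) (powerset xs)) + sumℚ (map f (powerset xs))
sumℚ-powerset-∷ f x xs = begin
  sumℚ (map f (map (x ∷_) P ++ P))              ≡⟨ cong sumℚ (map-++ f (map (x ∷_) P) P) ⟩
  sumℚ (map f (map (x ∷_) P) ++ map f P)        ≡⟨ sumℚ-++ (map f (map (x ∷_) P)) (map f P) ⟩
  sumℚ (map f (map (x ∷_) P)) + sumℚ (map f P)  ≡⟨ cong (λ ys → sumℚ ys + sumℚ (map f P)) (map-∘ P) ⟨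
  sumℚ (map (f ∘ (x ∷_)) P) + sumℚ (map f P)    ∎
  where
  open ≡-Reasoning
  P : List (List ℕ)
  P = powerset xs

applyUpTo≡iterate : ∀ (f : ℕ → ℕ) k → (∀ x → f x ≡ k ℕ.+ x) → ∀ n → applyUpTo f n ≡ iterate suc k n
applyUpTo≡iterate f k f≗k+ zero    = refl
applyUpTo≡iterate f k f≗k+ (suc n) = cong₂ _∷_ (trans (f≗k+ 0) (ℕ.+-identityʳ k))
  (applyUpTo≡iterate (f ∘ suc) (suc k) (λ x → trans (f≗k+ (suc x)) (ℕ.+-suc k x)) n)

oneTo≡iterate : ∀ n → oneTo n ≡ iterate suc 1 n
oneTo≡iterate n = trans (map-applyUpTo (λ x → x) suc n) (applyUpTo≡iterate suc 1 (λ _ → refl) n)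

triangle : ℕ → ℕ
triangle k = (k ℕ.* suc k) ℕ./ 2

triangle-suc : ∀ k → triangle (suc k) ≡ suc k ℕ.+ triangle k
triangle-suc k = begin
  (suc k ℕ.* suc (suc k)) ℕ./ 2          ≡⟨ cong (ℕ._/ 2) (expand k) ⟩
  (suc k ℕ.* 2 ℕ.+ k ℕ.* suc k) ℕ./ 2    ≡⟨ +-distrib-/-∣ˡ (k ℕ.* suc k) (divides (suc k) refl) ⟩
  (suc k ℕ.* 2) ℕ./ 2 ℕ.+ triangle k     ≡⟨ cong (ℕ._+ triangle k) (m*n/n≡m (suc k) 2) ⟩
  suc k ℕ.+ triangle k                   ∎
  where
  open ≡-Reasoning
  expand : ∀ k → suc k ℕ.* suc (suc k) ≡ suc k ℕ.* 2 ℕ.+ k ℕ.* suc k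
  expand = ℕ-Ring.solve-∀

-- The slack ½ⁿ(c + c) pays for the next step ½ⁿc and leaves ½ⁿ⁺¹(c + c),
-- so no geometric series has to be summed.
geometric-drift : ∀ (x : ℕ → ℚ) c → (∀ k → ∣ x (suc k) - x k ∣ ≤ ½ ^ℚ k * c) →
                  ∀ n → ∣ x n - x 0 ∣ ≤ c + c
geometric-drift x c step n = ≤-trans (p≤p+q (*-nonNeg (0≤½^ n) (+-mono-≤ 0≤c 0≤c)))
                                     (invariant n)
  where
  0≤c : 0ℚ ≤ c
  0≤c = subst (0ℚ ≤_) (*-identityˡ c) (≤-trans (0≤∣p∣ (x 1 - x 0)) (step 0))
  regroup : ∀ h c d → h * c + d + ½ * h * (c + c) ≡ d + h * (c + c)
  regroup = solve-∀ ℚ-ring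
  start : ∀ c → 0ℚ + 1ℚ * (c + c) ≡ c + c
  start = solve-∀ ℚ-ring
  invariant : ∀ n → ∣ x n - x 0 ∣ + ½ ^ℚ n * (c + c) ≤ c + c
  invariant zero    =
    ≤-reflexive (trans (cong (λ y → ∣ y ∣ + 1ℚ * (c + c)) (+-inverseʳ (x 0))) (start c))
  invariant (suc n) = begin
    ∣ x (suc n) - x 0 ∣ + ½ ^ℚ suc n * (c + c)
      ≤⟨ +-monoˡ-≤ _ (∣p-r∣≤∣p-q∣+∣q-r∣ (x (suc n)) (x n) (x 0)) ⟩
    ∣ x (suc n) - x n ∣ + ∣ x n - x 0 ∣ + ½ ^ℚ suc n * (c + c)
      ≤⟨ +-monoˡ-≤ _ (+-monoˡ-≤ _ (step n)) ⟩
    ½ ^ℚ n * c + ∣ x n - x 0 ∣ + ½ * ½ ^ℚ n * (c + c)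
      ≡⟨ regroup (½ ^ℚ n) c ∣ x n - x 0 ∣ ⟩
    ∣ x n - x 0 ∣ + ½ ^ℚ n * (c + c)
      ≤⟨ invariant n ⟩
    c + c ∎
    where open ≤-Reasoning

-- With q = ℓinv ℓ, poch ℓ and partialProd ℓ are qPoch and eulerProduct by definition.
module Euler (q : ℚ) where

  qPoch : ℕ → ℚ
  qPoch k = prodℚ (map (λ j → 1ℚ - q ^ℚ j) (oneTo k))

  -- Euler: (-qx; q)_∞ = Σ prodCoeff k xᵏ and 1 / (-qx; q)_∞ = Σ recipCoeff m xᵐ,
  -- where prodCoeff k = q^(k(k+1)/2) / (q; q)ₖ and recipCoeff m = (-q)ᵐ / (q; q)ₘ.
  prodCoeff : ℕ → ℚ
  prodCoeff k = q ^ℚ triangle k * inv (qPoch k)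

  recipCoeff : ℕ → ℚ
  recipCoeff zero    = 1ℚ
  recipCoeff (suc m) = - (q * recipCoeff m) * inv (1ℚ - q ^ℚ suc m)

  -- tailConvolution d n = Σ_{j ≤ n} prodCoeff (d + j) * recipCoeff (n - j)
  tailConvolution : ℕ → ℕ → ℚ
  tailConvolution d zero    = prodCoeff d
  tailConvolution d (suc n) = prodCoeff d * recipCoeff (suc n) + tailConvolution (suc d) n

  eulerSum : ℚ → ℕ → ℚ
  eulerSum z zero    = 0ℚ
  eulerSum z (suc M) = eulerSum z M + recipCoeff M * z ^ℚ M

  eulerProduct : ℕ → ℚ
  eulerProduct n = prodℚ (map (λ i → inv (1ℚ + q ^ℚ i)) (oneTo n))

  qPoch-suc : ∀ k → qPoch (suc k) ≡ qPoch k * (1ℚ - q ^ℚ suc k)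
  qPoch-suc = prodℚ-oneTo-suc (λ j → 1ℚ - q ^ℚ j)

  eulerProduct-suc : ∀ n → eulerProduct (suc n) ≡ eulerProduct n * inv (1ℚ + q ^ℚ suc n)
  eulerProduct-suc = prodℚ-oneTo-suc (λ i → inv (1ℚ + q ^ℚ i))

  module Identities (1-q^suc≢0 : ∀ m → 1ℚ - q ^ℚ suc m ≢ 0ℚ) where

    prodCoeff-suc : ∀ d → (1ℚ - q ^ℚ suc d) * prodCoeff (suc d) ≡ q ^ℚ suc d * prodCoeff d
    prodCoeff-suc d = begin
      D * (q ^ℚ triangle (suc d) * inv (qPoch (suc d)))
        ≡⟨ cong₂ (λ k P → D * (q ^ℚ k * inv P)) (triangle-suc d) (qPoch-suc d) ⟩
      D * (q ^ℚ (suc d ℕ.+ triangle d) * inv (qPoch d * D))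
        ≡⟨ cong₂ (λ u v → D * (u * v))
                 (^ℚ-distribˡ-+-* q (suc d) (triangle d)) (inv-distrib-* (qPoch d) D) ⟩
      D * (q ^ℚ suc d * q ^ℚ triangle d * (inv (qPoch d) * inv D))
        ≡⟨ regroup D (q ^ℚ suc d) (q ^ℚ triangle d) (inv (qPoch d)) (inv D) ⟩
      q ^ℚ suc d * prodCoeff d * inv D * D
        ≡⟨ p*inv[q]*q≡p (q ^ℚ suc d * prodCoeff d) (1-q^suc≢0 d) ⟩
      q ^ℚ suc d * prodCoeff d ∎
      where
      open ≡-Reasoning
      D : ℚ
      D = 1ℚ - q ^ℚ suc d
      regroup : ∀ d a b c i → d * (a * b * (c * i)) ≡ a * (b * c) * i * d
      regroup = solve-∀ ℚ-ring

    recipCoeff-suc : ∀ m → (1ℚ - q ^ℚ suc m) * recipCoeff (suc m) ≡ - (q * recipCoeff m)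
    recipCoeff-suc m = trans (*-comm (1ℚ - q ^ℚ suc m) (recipCoeff (suc m)))
                             (p*inv[q]*q≡p (- (q * recipCoeff m)) (1-q^suc≢0 m))

    -- C(qx) = C(x) for the product C of Σ prodCoeff k xᵏ and Σ recipCoeff m xᵐ, read off
    -- coefficientwise on the tails of the convolution; at d = 0 it forces C = 1.
    tailConvolution-shift : ∀ n d → q ^ℚ d * q ^ℚ n * tailConvolution d n ≡
                            tailConvolution d n - (1ℚ - q ^ℚ d) * prodCoeff d * recipCoeff n
    tailConvolution-shift zero    d = base (q ^ℚ d) (prodCoeff d)
      where
      base : ∀ x a → x * 1ℚ * a ≡ a - (1ℚ - x) * a * 1ℚ
      base = solve-∀ ℚ-ring
    tailConvolution-shift (suc n) d = begin
      X * (q * Y) * (A * E′ + G′)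
        ≡⟨ expand X q Y A E′ G′ ⟩
      X * q * Y * A * E′ + q * X * Y * G′
        ≡⟨ cong (X * q * Y * A * E′ +_) (tailConvolution-shift n (suc d)) ⟩
      X * q * Y * A * E′ + (G′ - (1ℚ - q * X) * A′ * E)
        ≡⟨ cong (λ w → X * q * Y * A * E′ + (G′ - w * E)) (prodCoeff-suc d) ⟩
      X * q * Y * A * E′ + (G′ - q * X * A * E)
        ≡⟨ rearrange X q Y A E E′ G′ ⟩
      A * E′ + G′ - (1ℚ - X) * A * E′ - X * A * ((1ℚ - q * Y) * E′ + q * E)
        ≡⟨ cong (λ w → A * E′ + G′ - (1ℚ - X) * A * E′ - X * A * (w + q * E))
                (recipCoeff-suc n) ⟩
      A * E′ + G′ - (1ℚ - X) * A * E′ - X * A * (- (q * E) + q * E)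
        ≡⟨ cancel (A * E′ + G′ - (1ℚ - X) * A * E′) (X * A) (q * E) ⟩
      A * E′ + G′ - (1ℚ - X) * A * E′ ∎
      where
      open ≡-Reasoning
      X Y A A′ E E′ G′ : ℚ
      X  = q ^ℚ d
      Y  = q ^ℚ n
      A  = prodCoeff d
      A′ = prodCoeff (suc d)
      E  = recipCoeff n
      E′ = recipCoeff (suc n)
      G′ = tailConvolution (suc d) n
      expand : ∀ x q y a e′ g′ → x * (q * y) * (a * e′ + g′) ≡ x * q * y * a * e′ + q * x * y * g′
      expand = solve-∀ ℚ-ring
      rearrange : ∀ x q y a e e′ g′ → x * q * y * a * e′ + (g′ - q * x * a * e) ≡
                  a * e′ + g′ - (1ℚ - x) * a * e′ - x * a * ((1ℚ - q * y) * e′ + q * e)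
      rearrange = solve-∀ ℚ-ring
      cancel : ∀ s c w → s - c * (- w + w) ≡ s
      cancel = solve-∀ ℚ-ring

    tailConvolution[0,1+n]≡0 : ∀ n → tailConvolution 0 (suc n) ≡ 0ℚ
    tailConvolution[0,1+n]≡0 n = p*q≡0⇒p≡0 (1-q^suc≢0 n) (begin
      G * (1ℚ - q ^ℚ suc n)               ≡⟨ distrib G (q ^ℚ suc n) ⟩
      G - 1ℚ * q ^ℚ suc n * G              ≡⟨ cong (λ w → G - w) (tailConvolution-shift (suc n) 0) ⟩
      G - (G - (1ℚ - 1ℚ) * 1ℚ * E′)        ≡⟨ vanish G E′ ⟩
      0ℚ                                   ∎)
      where
      open ≡-Reasoning
      G E′ : ℚ
      G  = tailConvolution 0 (suc n)
      E′ = recipCoeff (suc n)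
      distrib : ∀ g y → g * (1ℚ - y) ≡ g - 1ℚ * y * g
      distrib = solve-∀ ℚ-ring
      vanish : ∀ g e → g - (g - (1ℚ - 1ℚ) * 1ℚ * e) ≡ 0ℚ
      vanish = solve-∀ ℚ-ring

    recipCoeff-suc≡-tailConvolution : ∀ n → recipCoeff (suc n) ≡ - tailConvolution 1 n
    recipCoeff-suc≡-tailConvolution n = begin
      E′                                               ≡⟨ split E′ (tailConvolution 1 n) ⟩
      tailConvolution 0 (suc n) - tailConvolution 1 n  ≡⟨ cong (_- tailConvolution 1 n)
                                                               (tailConvolution[0,1+n]≡0 n) ⟩
      0ℚ - tailConvolution 1 n                         ≡⟨ +-identityˡ (- tailConvolution 1 n) ⟩
      - tailConvolution 1 n                            ∎
      where
      open ≡-Reasoning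
      E′ : ℚ
      E′ = recipCoeff (suc n)
      split : ∀ e g → e ≡ 1ℚ * e + g - g
      split = solve-∀ ℚ-ring

  module Estimates (0≤q : 0ℚ ≤ q) (3q≤1 : q + q + q ≤ 1ℚ) where

    q≤½ : q ≤ ½
    q≤½ = begin
      q            ≡⟨ halve q ⟩
      ½ * (q + q)  ≤⟨ *-monoˡ-≤-nonNeg ½ (≤-trans (p≤p+q {q + q} 0≤q) 3q≤1) ⟩
      ½ * 1ℚ       ≡⟨⟩
      ½            ∎
      where
      open ≤-Reasoning
      halve : ∀ x → x ≡ ½ * (x + x)
      halve = solve-∀ ℚ-ring

    ∣q∣≡q : ∣ q ∣ ≡ q
    ∣q∣≡q = 0≤p⇒∣p∣≡p 0≤q

    ∣q∣≤½ : ∣ q ∣ ≤ ½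
    ∣q∣≤½ = subst (_≤ ½) (sym ∣q∣≡q) q≤½

    ∣q∣≤1 : ∣ q ∣ ≤ 1ℚ
    ∣q∣≤1 = ≤-trans ∣q∣≤½ (<⇒≤ ½<1)

    q^suc≤q : ∀ m → q ^ℚ suc m ≤ q
    q^suc≤q m = begin
      q * q ^ℚ m  ≤⟨ *-monoˡ-≤-nonNeg q {{nonNegative 0≤q}} q^m≤1 ⟩
      q * 1ℚ      ≡⟨ *-identityʳ q ⟩
      q           ∎
      where
      open ≤-Reasoning
      q^m≤1 : q ^ℚ m ≤ 1ℚ
      q^m≤1 = subst (_≤ 1ℚ) (0≤p⇒∣p∣≡p (^ℚ-nonNeg m 0≤q)) (∣^ℚ∣≤1 m ∣q∣≤1)

    q+q≤1-q^suc : ∀ m → q + q ≤ 1ℚ - q ^ℚ suc m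
    q+q≤1-q^suc m = subst (_≤ 1ℚ - q ^ℚ suc m) (cancel (q + q) (q ^ℚ suc m))
      (+-monoˡ-≤ (- q ^ℚ suc m) (≤-trans (+-monoʳ-≤ (q + q) (q^suc≤q m)) 3q≤1))
      where
      cancel : ∀ a b → a + b - b ≡ a
      cancel = solve-∀ ℚ-ring

    0<1-q^suc : ∀ m → 0ℚ < 1ℚ - q ^ℚ suc m
    0<1-q^suc m = 0<1-p (≤-<-trans (q^suc≤q m) (≤-<-trans q≤½ ½<1))

    1-q^suc≢0 : ∀ m → 1ℚ - q ^ℚ suc m ≢ 0ℚ
    1-q^suc≢0 m = ≢-sym (<⇒≢ (0<1-q^suc m))

    open Identities 1-q^suc≢0

    ∣recipCoeff∣≤½^ : ∀ m → ∣ recipCoeff m ∣ ≤ ½ ^ℚ m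
    ∣recipCoeff∣≤½^ zero    = ≤-refl
    ∣recipCoeff∣≤½^ (suc m) = *-cancelˡ-≤-pos D {{positive (0<1-q^suc m)}} (begin
      D * ∣ E′ ∣                 ≡⟨ cong (_* ∣ E′ ∣) (sym (0≤p⇒∣p∣≡p (<⇒≤ (0<1-q^suc m)))) ⟩
      ∣ D ∣ * ∣ E′ ∣             ≡⟨ sym (∣p*q∣≡∣p∣*∣q∣ D E′) ⟩
      ∣ D * E′ ∣                 ≡⟨ cong ∣_∣ (recipCoeff-suc m) ⟩
      ∣ - (q * recipCoeff m) ∣   ≡⟨ ∣-p∣≡∣p∣ (q * recipCoeff m) ⟩
      ∣ q * recipCoeff m ∣       ≤⟨ ∣*∣-mono-≤ (≤-reflexive ∣q∣≡q) (∣recipCoeff∣≤½^ m) ⟩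
      q * ½ ^ℚ m                 ≡⟨ halve q (½ ^ℚ m) ⟩
      (q + q) * ½ ^ℚ suc m       ≤⟨ *-monoʳ-≤-nonNeg (½ ^ℚ suc m) {{nonNegative (0≤½^ (suc m))}}
                                      (q+q≤1-q^suc m) ⟩
      D * ½ ^ℚ suc m             ∎)
      where
      open ≤-Reasoning
      D E′ : ℚ
      D  = 1ℚ - q ^ℚ suc m
      E′ = recipCoeff (suc m)
      halve : ∀ a b → a * b ≡ (a + a) * (½ * b)
      halve = solve-∀ ℚ-ring

    -- The truncated form of E(qz) = (1 + qz) E(z) for E(z) = 1 / (-qz; q)_∞.
    eulerSum-q* : ∀ z M →
                  eulerSum (q * z) (suc M) ≡ (1ℚ + q * z) * eulerSum z M + recipCoeff M * z ^ℚ M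
    eulerSum-q* z zero    = cong (_+ 1ℚ) (sym (*-zeroʳ (1ℚ + q * z)))
    eulerSum-q* z (suc M) = begin
      eulerSum (q * z) (suc M) + E′ * (q * z) ^ℚ suc M
        ≡⟨ cong₂ _+_ (eulerSum-q* z M) (cong (E′ *_) (^ℚ-distribʳ-* q z (suc M))) ⟩
      (1ℚ + q * z) * S + E * zᴹ + E′ * (q ^ℚ suc M * (z * zᴹ))
        ≡⟨ rearrange q z S E zᴹ E′ (q ^ℚ suc M) ⟩
      R - ((1ℚ - q ^ℚ suc M) * E′ + q * E) * (z * zᴹ)
        ≡⟨ cong (λ w → R - (w + q * E) * (z * zᴹ)) (recipCoeff-suc M) ⟩
      R - (- (q * E) + q * E) * (z * zᴹ)
        ≡⟨ cancel R (q * E) (z * zᴹ) ⟩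
      R ∎
      where
      open ≡-Reasoning
      S E E′ zᴹ R : ℚ
      S  = eulerSum z M
      E  = recipCoeff M
      E′ = recipCoeff (suc M)
      zᴹ = z ^ℚ M
      R  = (1ℚ + q * z) * (S + E * zᴹ) + E′ * (z * zᴹ)
      rearrange : ∀ q z s e zᴹ e′ qᴹ →
                  (1ℚ + q * z) * s + e * zᴹ + e′ * (qᴹ * (z * zᴹ)) ≡
                  (1ℚ + q * z) * (s + e * zᴹ) + e′ * (z * zᴹ)
                    - ((1ℚ - qᴹ) * e′ + q * e) * (z * zᴹ)
      rearrange = solve-∀ ℚ-ring
      cancel : ∀ r w v → r - (- w + w) * v ≡ r
      cancel = solve-∀ ℚ-ring

    eulerProduct-suc-cancel : ∀ n → eulerProduct (suc n) * (1ℚ + q ^ℚ suc n) ≡ eulerProduct n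
    eulerProduct-suc-cancel n = trans (cong (_* (1ℚ + q ^ℚ suc n)) (eulerProduct-suc n))
      (p*inv[q]*q≡p (eulerProduct n) (≢-sym (<⇒≢ (<-≤-trans (positive⁻¹ 1ℚ) (1≤1+q^ (suc n))))))
      where
      1≤1+q^ : ∀ k → 1ℚ ≤ 1ℚ + q ^ℚ k
      1≤1+q^ k = p≤p+q (^ℚ-nonNeg k 0≤q)

    ∣eulerProduct∣≤1 : ∀ n → ∣ eulerProduct n ∣ ≤ 1ℚ
    ∣eulerProduct∣≤1 zero    = ≤-refl
    ∣eulerProduct∣≤1 (suc n) = subst (λ p → ∣ p ∣ ≤ 1ℚ) (sym (eulerProduct-suc n))
      (∣*∣-mono-≤ (∣eulerProduct∣≤1 n) (∣inv∣≤1 (p≤p+q (^ℚ-nonNeg (suc n) 0≤q))))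

    ∣eulerSum-1∣≤∣z∣ : ∀ {z} N → ∣ z ∣ ≤ 1ℚ → ∣ eulerSum z (suc N) - 1ℚ ∣ ≤ ∣ z ∣
    ∣eulerSum-1∣≤∣z∣ {z} N ∣z∣≤1 = subst (∣ eulerSum z (suc N) - 1ℚ ∣ ≤_) (halves ∣ z ∣)
      (geometric-drift (λ k → eulerSum z (suc k)) (½ * ∣ z ∣) step N)
      where
      halves : ∀ x → ½ * x + ½ * x ≡ x
      halves = solve-∀ ℚ-ring
      last-term : ∀ s t → s + t - s ≡ t
      last-term = solve-∀ ℚ-ring
      regroup : ∀ h x → ½ * h * (x * 1ℚ) ≡ h * (½ * x)
      regroup = solve-∀ ℚ-ring
      step : ∀ k → ∣ eulerSum z (suc (suc k)) - eulerSum z (suc k) ∣ ≤ ½ ^ℚ k * (½ * ∣ z ∣)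
      step k = begin
        ∣ eulerSum z (suc (suc k)) - eulerSum z (suc k) ∣
          ≡⟨ cong ∣_∣ (last-term (eulerSum z (suc k)) (recipCoeff (suc k) * z ^ℚ suc k)) ⟩
        ∣ recipCoeff (suc k) * (z * z ^ℚ k) ∣
          ≤⟨ ∣*∣-mono-≤ (∣recipCoeff∣≤½^ (suc k)) (∣*∣-mono-≤ (≤-refl {∣ z ∣}) (∣^ℚ∣≤1 k ∣z∣≤1)) ⟩
        ½ * ½ ^ℚ k * (∣ z ∣ * 1ℚ)
          ≡⟨ regroup (½ ^ℚ k) ∣ z ∣ ⟩
        ½ ^ℚ k * (½ * ∣ z ∣) ∎
        where open ≤-Reasoning

    -- Dividing by 1 + qᵏ⁺¹ trades eulerSum (qᵏ) (k + M) for eulerSum (qᵏ⁺¹) (k + 1 + M)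
    -- at the cost of one term of size at most ½^(k + M).
    eulerProduct-telescope : ∀ M n →
      ∣ eulerProduct n * eulerSum (q ^ℚ n) (n ℕ.+ M) - eulerSum 1ℚ M ∣ ≤ ½ ^ℚ M + ½ ^ℚ M
    eulerProduct-telescope M n = subst (λ s → ∣ X n - s ∣ ≤ ½ ^ℚ M + ½ ^ℚ M) (*-identityˡ (eulerSum 1ℚ M))
      (geometric-drift X (½ ^ℚ M) step n)
      where
      X : ℕ → ℚ
      X k = eulerProduct k * eulerSum (q ^ℚ k) (k ℕ.+ M)
      collect : ∀ p′ b s c p → p′ * (b * s + c) - p * s ≡ (p′ * b - p) * s + p′ * c
      collect = solve-∀ ℚ-ring
      cancel : ∀ p s t → (p - p) * s + t ≡ t
      cancel = solve-∀ ℚ-ring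
      X-step : ∀ k →
               X (suc k) - X k ≡ eulerProduct (suc k) * (recipCoeff (k ℕ.+ M) * (q ^ℚ k) ^ℚ (k ℕ.+ M))
      X-step k = begin
        P′ * eulerSum (q * q ^ℚ k) (suc (k ℕ.+ M)) - P * S
          ≡⟨ cong (λ s → P′ * s - P * S) (eulerSum-q* (q ^ℚ k) (k ℕ.+ M)) ⟩
        P′ * (B * S + C) - P * S
          ≡⟨ collect P′ B S C P ⟩
        (P′ * B - P) * S + P′ * C
          ≡⟨ cong (λ w → (w - P) * S + P′ * C) (eulerProduct-suc-cancel k) ⟩
        (P - P) * S + P′ * C
          ≡⟨ cancel P S (P′ * C) ⟩
        P′ * C ∎
        where
        open ≡-Reasoning
        P P′ B S C : ℚ
        P  = eulerProduct k
        P′ = eulerProduct (suc k)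
        B  = 1ℚ + q ^ℚ suc k
        S  = eulerSum (q ^ℚ k) (k ℕ.+ M)
        C  = recipCoeff (k ℕ.+ M) * (q ^ℚ k) ^ℚ (k ℕ.+ M)
      step : ∀ k → ∣ X (suc k) - X k ∣ ≤ ½ ^ℚ k * ½ ^ℚ M
      step k = begin
        ∣ X (suc k) - X k ∣
          ≡⟨ cong ∣_∣ (X-step k) ⟩
        ∣ eulerProduct (suc k) * (recipCoeff (k ℕ.+ M) * (q ^ℚ k) ^ℚ (k ℕ.+ M)) ∣
          ≤⟨ ∣*∣-mono-≤ (∣eulerProduct∣≤1 (suc k))
               (∣*∣-mono-≤ (∣recipCoeff∣≤½^ (k ℕ.+ M)) (∣^ℚ∣≤1 (k ℕ.+ M) (∣^ℚ∣≤1 k ∣q∣≤1))) ⟩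
        1ℚ * (½ ^ℚ (k ℕ.+ M) * 1ℚ)
          ≡⟨ trans (*-identityˡ _) (*-identityʳ _) ⟩
        ½ ^ℚ (k ℕ.+ M)
          ≡⟨ ^ℚ-distribˡ-+-* ½ k M ⟩
        ½ ^ℚ k * ½ ^ℚ M ∎
        where open ≤-Reasoning

    ∣eulerSum-eulerProduct∣≤3*½^ : ∀ n → ∣ eulerSum 1ℚ n - eulerProduct n ∣ ≤ ℕ→ℚ 3 * ½ ^ℚ n
    ∣eulerSum-eulerProduct∣≤3*½^ zero          = ≤ᵇ⇒≤ tt
    ∣eulerSum-eulerProduct∣≤3*½^ n@(suc n-1) = begin
      ∣ S - P ∣
        ≡⟨ cong ∣_∣ (split S P Σ) ⟩
      ∣ - (P * Σ - S) + P * (Σ - 1ℚ) ∣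
        ≤⟨ ∣p+q∣≤∣p∣+∣q∣ (- (P * Σ - S)) (P * (Σ - 1ℚ)) ⟩
      ∣ - (P * Σ - S) ∣ + ∣ P * (Σ - 1ℚ) ∣
        ≡⟨ cong (_+ ∣ P * (Σ - 1ℚ) ∣) (∣-p∣≡∣p∣ (P * Σ - S)) ⟩
      ∣ P * Σ - S ∣ + ∣ P * (Σ - 1ℚ) ∣
        ≤⟨ +-mono-≤ (eulerProduct-telescope n n)
             (∣*∣-mono-≤ (∣eulerProduct∣≤1 n)
               (≤-trans (∣eulerSum-1∣≤∣z∣ (n-1 ℕ.+ n) (∣^ℚ∣≤1 n ∣q∣≤1)) (∣^ℚ∣≤^ℚ n ∣q∣≤½))) ⟩
      ½ ^ℚ n + ½ ^ℚ n + 1ℚ * ½ ^ℚ n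
        ≡⟨ triple (½ ^ℚ n) ⟩
      ℕ→ℚ 3 * ½ ^ℚ n ∎
      where
      open ≤-Reasoning
      S P Σ : ℚ
      S = eulerSum 1ℚ n
      P = eulerProduct n
      Σ = eulerSum (q ^ℚ n) (n ℕ.+ n)
      split : ∀ s p σ → s - p ≡ - (p * σ - s) + p * (σ - 1ℚ)
      split = solve-∀ ℚ-ring
      triple : ∀ y → y + y + 1ℚ * y ≡ ℕ→ℚ 3 * y
      triple = solve-∀ ℚ-ring

module Chains (ℓ : ℕ) where
  open Euler (ℓinv ℓ)

  r≡-prodCoeff : ∀ k → r ℓ k ≡ - prodCoeff k
  r≡-prodCoeff k = cong -_ (begin
    inv (ℕ→ℚ (ℓ ℕ.^ triangle k) * poch ℓ k)          ≡⟨ inv-distrib-* (ℕ→ℚ (ℓ ℕ.^ triangle k)) (poch ℓ k) ⟩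
    inv (ℕ→ℚ (ℓ ℕ.^ triangle k)) * inv (poch ℓ k)    ≡⟨ cong (_* inv (poch ℓ k)) (inv-ℕ→ℚ-^ ℓ (triangle k)) ⟩
    ℓinv ℓ ^ℚ triangle k * inv (poch ℓ k)            ∎)
    where open ≡-Reasoning

  chainSum : ℕ → List ℕ → ℕ → ℚ
  chainSum p xs i = sumℚ (map (λ S → rChain ℓ p S i) (powerset xs))

  chainSum-∷ : ∀ p x xs i →
               chainSum p (x ∷ xs) i ≡ r ℓ (x ℕ.∸ p) * chainSum x xs i + chainSum p xs i
  chainSum-∷ p x xs i =
    trans (sumℚ-powerset-∷ (λ S → rChain ℓ p S i) x xs)
          (cong (_+ chainSum p xs i) (sumℚ-map-*ˡ (r ℓ (x ℕ.∸ p)) (λ S → rChain ℓ x S i) (powerset xs)))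

  module _ (1-q^suc≢0 : ∀ m → 1ℚ - ℓinv ℓ ^ℚ suc m ≢ 0ℚ) where
    open Identities 1-q^suc≢0

    chainSum-iterate : ∀ n d p →
                       chainSum p (iterate suc (d ℕ.+ p) n) (n ℕ.+ (d ℕ.+ p)) ≡ - tailConvolution d n
    chainSum-iterate zero d p = begin
      r ℓ (d ℕ.+ p ℕ.∸ p) + 0ℚ   ≡⟨ +-identityʳ _ ⟩
      r ℓ (d ℕ.+ p ℕ.∸ p)        ≡⟨ cong (r ℓ) (ℕ.m+n∸n≡m d p) ⟩
      r ℓ d                      ≡⟨ r≡-prodCoeff d ⟩
      - prodCoeff d              ∎
      where open ≡-Reasoning
    chainSum-iterate (suc n) d p = begin
      chainSum p (iterate suc (d ℕ.+ p) (suc n)) (suc n ℕ.+ (d ℕ.+ p))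
        ≡⟨ cong (chainSum p (iterate suc (d ℕ.+ p) (suc n))) (sym (ℕ.+-suc n (d ℕ.+ p))) ⟩
      chainSum p (d ℕ.+ p ∷ iterate suc (suc (d ℕ.+ p)) n) (n ℕ.+ suc (d ℕ.+ p))
        ≡⟨ chainSum-∷ p (d ℕ.+ p) (iterate suc (suc (d ℕ.+ p)) n) (n ℕ.+ suc (d ℕ.+ p)) ⟩
      r ℓ (d ℕ.+ p ℕ.∸ p)
          * chainSum (d ℕ.+ p) (iterate suc (1 ℕ.+ (d ℕ.+ p)) n) (n ℕ.+ (1 ℕ.+ (d ℕ.+ p)))
        + chainSum p (iterate suc (suc d ℕ.+ p) n) (n ℕ.+ (suc d ℕ.+ p))
        ≡⟨ cong₂ (λ u v → r ℓ (d ℕ.+ p ℕ.∸ p) * u + v)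
                 (chainSum-iterate n 1 (d ℕ.+ p)) (chainSum-iterate n (suc d) p) ⟩
      r ℓ (d ℕ.+ p ℕ.∸ p) * - tailConvolution 1 n + - tailConvolution (suc d) n
        ≡⟨ cong (λ k → r ℓ k * - tailConvolution 1 n + - tailConvolution (suc d) n) (ℕ.m+n∸n≡m d p) ⟩
      r ℓ d * - tailConvolution 1 n + - tailConvolution (suc d) n
        ≡⟨ cong₂ (λ a e → a * e + - tailConvolution (suc d) n)
                 (r≡-prodCoeff d) (sym (recipCoeff-suc≡-tailConvolution n)) ⟩
      - prodCoeff d * recipCoeff (suc n) + - tailConvolution (suc d) n
        ≡⟨ neg-out (prodCoeff d) (recipCoeff (suc n)) (tailConvolution (suc d) n) ⟩
      - tailConvolution d (suc n) ∎
      where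
      open ≡-Reasoning
      neg-out : ∀ a e g → - a * e + - g ≡ - (a * e + g)
      neg-out = solve-∀ ℚ-ring

    t≡recipCoeff : ∀ n → t ℓ n ≡ recipCoeff n
    t≡recipCoeff zero    = refl
    t≡recipCoeff (suc m) = begin
      chainSum 0 (oneTo m) (suc m)            ≡⟨ cong₂ (chainSum 0) (oneTo≡iterate m) (ℕ.+-comm 1 m) ⟩
      chainSum 0 (iterate suc 1 m) (m ℕ.+ 1)  ≡⟨ chainSum-iterate m 1 0 ⟩
      - tailConvolution 1 m                   ≡⟨ sym (recipCoeff-suc≡-tailConvolution m) ⟩
      recipCoeff (suc m)                      ∎
      where open ≡-Reasoning

    partialSum≡eulerSum : ∀ n → partialSum ℓ n ≡ eulerSum 1ℚ n
    partialSum≡eulerSum zero    = refl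
    partialSum≡eulerSum (suc n) = begin
      sumℚ (map (t ℓ) (upTo (suc n)))          ≡⟨ sumℚ-upTo-suc (t ℓ) n ⟩
      partialSum ℓ n + t ℓ n                   ≡⟨ cong₂ _+_ (partialSum≡eulerSum n) (t≡recipCoeff n) ⟩
      eulerSum 1ℚ n + recipCoeff n             ≡⟨ cong (eulerSum 1ℚ n +_) (sym 1^ℚn-factor) ⟩
      eulerSum 1ℚ n + recipCoeff n * 1ℚ ^ℚ n   ∎
      where
      open ≡-Reasoning
      1^ℚn-factor : recipCoeff n * 1ℚ ^ℚ n ≡ recipCoeff n
      1^ℚn-factor = trans (cong (recipCoeff n *_) (1^ℚn≡1 n)) (*-identityʳ (recipCoeff n))

0≤ℓinv : ∀ ℓ → 0ℚ ≤ ℓinv ℓ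
0≤ℓinv zero    = ≤-refl
0≤ℓinv (suc ℓ) = <⇒≤ (inv-pos (ℕ→ℚ-mono-< (s≤s (z≤n {ℓ}))))

ℓinv+ℓinv+ℓinv≤1 : ∀ {ℓ} → 3 ℕ.≤ ℓ → ℓinv ℓ + ℓinv ℓ + ℓinv ℓ ≤ 1ℚ
ℓinv+ℓinv+ℓinv≤1 {ℓ} 3≤ℓ = begin
  ℓinv ℓ + ℓinv ℓ + ℓinv ℓ   ≡⟨ triple (ℓinv ℓ) ⟩
  ℓinv ℓ * ℕ→ℚ 3             ≤⟨ *-monoˡ-≤-nonNeg (ℓinv ℓ) {{nonNegative (0≤ℓinv ℓ)}} (ℕ→ℚ-mono-≤ 3≤ℓ) ⟩
  ℓinv ℓ * ℕ→ℚ ℓ             ≡⟨ inv-inverseˡ (≢-sym (<⇒≢ (ℕ→ℚ-mono-< (ℕ.≤-trans (s≤s z≤n) 3≤ℓ)))) ⟩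
  1ℚ                         ∎
  where
  open ≤-Reasoning
  triple : ∀ x → x + x + x ≡ x * ℕ→ℚ 3
  triple = solve-∀ ℚ-ring

odd-prime⇒3≤ : ∀ {ℓ} → Prime ℓ → ¬ 2 ∣ ℓ → 3 ℕ.≤ ℓ
odd-prime⇒3≤ {0}                 ℓ-prime _   = contradiction ℓ-prime ¬prime[0]
odd-prime⇒3≤ {1}                 ℓ-prime _   = contradiction ℓ-prime ¬prime[1]
odd-prime⇒3≤ {2}                 _       2∤2 = contradiction ∣-refl 2∤2
odd-prime⇒3≤ {suc (suc (suc _))} _       _   = s≤s (s≤s (s≤s z≤n))

mainTheorem12 : (ℓ : ℕ) → Prime ℓ → ¬ (2 ∣ ℓ) →
    (ε : ℚ) → 0ℚ < ε →
    ∃ λ (N : ℕ) → (n : ℕ) → N ℕ.≤ n →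
      ∣ partialSum ℓ n - partialProd ℓ n ∣ < ε
mainTheorem12 ℓ ℓ-prime ℓ-odd ε 0<ε =
  map₂ (λ small n N≤n → ≤-<-trans (bound n) (small n N≤n)) (c*½^n-eventually< 3 ε 0<ε)
  where
  open Euler.Estimates (ℓinv ℓ) (0≤ℓinv ℓ) (ℓinv+ℓinv+ℓinv≤1 (odd-prime⇒3≤ ℓ-prime ℓ-odd))
  bound : ∀ n → ∣ partialSum ℓ n - partialProd ℓ n ∣ ≤ ℕ→ℚ 3 * ½ ^ℚ n
  bound n = subst (λ s → ∣ s - partialProd ℓ n ∣ ≤ ℕ→ℚ 3 * ½ ^ℚ n)
                  (sym (Chains.partialSum≡eulerSum ℓ 1-q^suc≢0 n))
                  (∣eulerSum-eulerProduct∣≤3*½^ n)
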